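{- Let $\mathfrak{A}$ be a Heyting algebra and let $a,a^{*}\in|\mathfrak{A}|$ be such that $a$ is enriched with $a^{*}$ in $\mathfrak{A}$. Then the operation $\sim x=(x\rightarrow a)\wedge a^{*}$ is a $\sim$-negation on $\mathfrak{A}$, and $a=\sim\mathbf{1}$, $a^{*}=\sim\mathbf{0}$.
   Context: In a Heyting algebra $\mathfrak{A}$, $b$ enriches $a$ if $a\le b$, $b\rightarrow a=a$, and $b\le x\vee(x\rightarrow a)$ for all $x\in|\mathfrak{A}|$. A $\sim$-negation on a Heyting algebra is a unary operation $\sim$ satisfying for all $x,y$: $x\rightarrow y\le\sim y\rightarrow\sim x$; $x\wedge\sim x\le\sim\mathbf{1}$; $\sim\mathbf{0}\le x\vee\sim x$; $\sim\mathbf{0}\rightarrow\sim\mathbf{1}\le\sim\mathbf{1}$. -}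

module Defs where

open import Level using (Level; _⊔_)
open import Data.Product using (_×_)
open import Relation.Binary.Lattice.Bundles using (HeytingAlgebra)

module _ {c ℓ₁ ℓ₂ : Level} (H : HeytingAlgebra c ℓ₁ ℓ₂) where
  open HeytingAlgebra H

  Enriches : Carrier → Carrier → Set (c ⊔ ℓ₁ ⊔ ℓ₂)
  Enriches b a = (a ≤ b) × ((b ⇨ a) ≈ a) × (∀ x → b ≤ (x ∨ (x ⇨ a)))

  IsSimNegation : (Carrier → Carrier) → Set (c ⊔ ℓ₂)
  IsSimNegation n =
      (∀ x y → (x ⇨ y) ≤ (n y ⇨ n x))
    × (∀ x → (x ∧ n x) ≤ n ⊤)
    × (∀ x → n ⊥ ≤ (x ∨ n x))
    × ((n ⊥ ⇨ n ⊤) ≤ n ⊤)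

-- The map x ↦ (x ⇨ a) ∧ b is antitone for implication and satisfies x ∧ ∼x ≤ a for
-- arbitrary a and b; ∼⊥ = b always and ∼⊤ = a as soon as a ≤ b. The remaining two
-- axioms are then exactly the other two enrichment conditions: b ≤ x ∨ (x ⇨ a) gives
-- excluded middle relative to ∼⊥, and b ⇨ a = a is the axiom (∼⊥ ⇨ ∼⊤) ≤ ∼⊤.
module Submission where

open import Defs
open import Level using (Level)
open import Data.Product using (_×_; _,_)
open import Relation.Binary.Lattice.Bundles using (HeytingAlgebra)
import Relation.Binary.Lattice.Properties.HeytingAlgebra as HeytingProperties
import Relation.Binary.Lattice.Properties.MeetSemilattice as MeetProperties
import Relation.Binary.Lattice.Properties.JoinSemilattice as JoinProperties
import Relation.Binary.Reasoning.PartialOrder as ≤-Reasoning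

module _ {c ℓ₁ ℓ₂ : Level} (H : HeytingAlgebra c ℓ₁ ℓ₂) where
  open HeytingAlgebra H
  open HeytingProperties H
  open MeetProperties meetSemilattice using (∧-comm; ∧-monotonic)
  open JoinProperties joinSemilattice using (∨-monotonic)
  open ≤-Reasoning poset

  ⇨-trans : ∀ {x y z} → (x ⇨ y) ∧ (y ⇨ z) ≤ x ⇨ z
  ⇨-trans = transpose-⇨ (trans
    (∧-greatest (trans (x∧y≤x _ _) (x∧y≤y _ _)) (trans (∧-monotonic (x∧y≤x _ _) refl) ⇨-eval))
    ⇨-eval)

  ⊤⇨x≤x : ∀ {x} → ⊤ ⇨ x ≤ x
  ⊤⇨x≤x = trans (∧-greatest refl (maximum _)) ⇨-eval

  ∼[_,_] : Carrier → Carrier → Carrier → Carrier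
  ∼[ a , b ] x = (x ⇨ a) ∧ b

  module _ (a b : Carrier) where
    private
      ∼ = ∼[ a , b ]

    ∼-antitone-⇨ : ∀ x y → x ⇨ y ≤ ∼ y ⇨ ∼ x
    ∼-antitone-⇨ x y = transpose-⇨ (∧-greatest
      (trans (∧-monotonic refl (x∧y≤x _ _)) ⇨-trans)
      (trans (x∧y≤y _ _) (x∧y≤y _ _)))

    x∧∼x≤a : ∀ x → x ∧ ∼ x ≤ a
    x∧∼x≤a x = trans (∧-monotonic refl (x∧y≤x _ _)) (⇨-applyʳ refl)

    ∼⊥≈b : ∼ ⊥ ≈ b
    ∼⊥≈b = antisym (x∧y≤y _ _)
      (∧-greatest (transpose-⇨ (trans (x∧y≤y _ _) (minimum _))) refl)

    ∼⊤≈a : a ≤ b → ∼ ⊤ ≈ a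
    ∼⊤≈a a≤b = antisym (trans (x∧y≤x _ _) ⊤⇨x≤x) (∧-greatest y≤x⇨y a≤b)

    ∼⊥≤x∨∼x : ∀ x → b ≤ x ∨ (x ⇨ a) → ∼ ⊥ ≤ x ∨ ∼ x
    ∼⊥≤x∨∼x x b≤x∨x⇨a = begin
      ∼ ⊥                       ≤⟨ x∧y≤y _ _ ⟩
      b                         ≤⟨ ∧-greatest refl b≤x∨x⇨a ⟩
      b ∧ (x ∨ (x ⇨ a))         ≤⟨ ∧-distribˡ-∨-≤ b x (x ⇨ a) ⟩
      (b ∧ x) ∨ (b ∧ (x ⇨ a))   ≤⟨ ∨-monotonic (x∧y≤y _ _) (reflexive (∧-comm _ _)) ⟩
      x ∨ ∼ x                   ∎

    ∼-isSimNegation : a ≤ b → (b ⇨ a) ≈ a → (∀ x → b ≤ x ∨ (x ⇨ a))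
                    → IsSimNegation H ∼
    ∼-isSimNegation a≤b b⇨a≈a b≤x∨x⇨a =
        ∼-antitone-⇨
      , (λ x → trans (x∧∼x≤a x) (reflexive (Eq.sym (∼⊤≈a a≤b))))
      , (λ x → ∼⊥≤x∨∼x x (b≤x∨x⇨a x))
      , (begin
          ∼ ⊥ ⇨ ∼ ⊤   ≈⟨ ⇨-cong ∼⊥≈b (∼⊤≈a a≤b) ⟩
          b ⇨ a       ≈⟨ b⇨a≈a ⟩
          a           ≈⟨ Eq.sym (∼⊤≈a a≤b) ⟩
          ∼ ⊤         ∎)

propositionP : {c ℓ₁ ℓ₂ : Level} (H : HeytingAlgebra c ℓ₁ ℓ₂)
    → (a a* : HeytingAlgebra.Carrier H)
    → Enriches H a* a
    → let open HeytingAlgebra H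
          ∼ = λ x → (x ⇨ a) ∧ a*
      in IsSimNegation H ∼ × (a ≈ ∼ ⊤) × (a* ≈ ∼ ⊥)
propositionP H a a* (a≤a* , a*⇨a≈a , a*≤x∨x⇨a) =
    ∼-isSimNegation H a a* a≤a* a*⇨a≈a a*≤x∨x⇨a
  , Eq.sym (∼⊤≈a H a a* a≤a*)
  , Eq.sym (∼⊥≈b H a a*)
  where open HeytingAlgebra H using (module Eq)
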